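{- For every epistemic program $\Pi$ (a set of rules as defined in the context), every equilibrium world view of $\Pi$ is founded with respect to $\Pi$. (That is, Founded Autoepistemic Equilibrium Logic satisfies foundedness.)
   Context: Fix a set $\mathrm{At}$ of atoms. Formulas: $\varphi ::= \bot \mid a \mid \varphi_1\wedge\varphi_2 \mid \varphi_1\vee\varphi_2\mid \varphi_1\to\varphi_2 \mid \mathbf{L}\varphi$; $\neg\varphi := \varphi\to\bot$, $\top:=\neg\bot$, $\varphi\leftarrow\psi := \psi\to\varphi$. A propositional interpretation is $I\subseteq\mathrm{At}$; a belief view $\mathcal W$ is a set of them. Classical modal satisfaction $\langle\mathcal W,I\rangle\models\varphi$: classical for $\bot,\wedge,\vee,\to$, $\langle\mathcal W,I\rangle\models a$ iff $a\in I$, and $\langle\mathcal W,I\rangle\models\mathbf L\psi$ iff $\langle\mathcal W,J\rangle\models\psi$ for all $J\in\mathcal W$. Programs. An objective literal is $a$, $\neg a$ or $\neg\neg a$; a subjective literal is $\mathbf L l$, $\neg\mathbf L l$, $\neg\neg\mathbf L l$ with $l$ objective; a literal is positive if it contains no negation. A rule $r$ is $a_1\vee\dots\vee a_n\leftarrow B_1\wedge\dots\wedge B_m$ ($n,m\ge 0$, $n+m>0$, $a_i$ atoms, $B_j$ literals), $\mathrm{Head}(r)=\{a_1,\dots,a_n\}$, $\mathrm{Body}(r)=B_1\wedge\dots\wedge B_m$; $\mathrm{Body}^+_{ob}(r)=\{a : a \text{ is some } B_j\}$, $\mathrm{Body}^+_{sub}(r)=\{a : \mathbf L a \text{ is some }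 B_j\}$. A program is a set of rules. Unfounded set w.r.t. $\Pi$ and $\mathcal W$: a non-empty set $\mathcal U$ of pairs $\langle X,I\rangle$ of sets of atoms such that, with $Y=\bigcup\{X':\langle X',I'\rangle\in\mathcal U\}$, for each $\langle X,I\rangle\in\mathcal U$ no rule $r\in\Pi$ with $\mathrm{Head}(r)\cap X\ne\emptyset$ satisfies all of: (1) $\langle\mathcal W,I\rangle\models\mathrm{Body}(r)$; (2) $\mathrm{Body}^+_{ob}(r)\cap X=\emptyset$; (3) $(\mathrm{Head}(r)\setminus X)\cap I=\emptyset$; (4) $\mathrm{Body}^+_{sub}(r)\cap Y=\emptyset$. $\mathcal W$ is unfounded if some unfounded set $\mathcal U$ has $I\in\mathcal W$ and $X\cap I\ne\emptyset$ for all $\langle X,I\rangle\in\mathcal U$; founded otherwise. FAEEL. HT belief views are non-empty sets $\mathcal W$ of pairs $\langle H_i,T_i\rangle$, $H_i\subseteq T_i\subseteq\mathrm{At}$; $\mathcal W^t=\{T_i\}$; total if all $H_i=T_i$. For $\mathcal I=\langle\mathcal W,H,T\rangle$ with $H\subseteq T$: $\mathcal I\not\models\bot$; $\mathcal I\models a$ iff $a\in H$; $\wedge,\vee$ componentwise; $\mathcal I\models\psi_1\to\psi_2$ iff ($\mathcal I\not\models\psi_1$ or $\mathcal I\models\psi_2$) and ($\langle\mathcal W^t,T,T\rangle\not\models\psi_1$ or $\langle\mathcal W^t,T,T\rangle\models\psi_2$); $\mathcal I\models\mathbf L\psi$ iff $\langle\mathcal W,H_i,T_i\rangle\models\psi$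 for all $\langle H_i,T_i\rangle\in\mathcal W$. Belief model of $\Gamma$: $\langle\mathcal W,H_i,T_i\rangle\models\varphi$ for all $\varphi\in\Gamma$ and all $\langle H_i,T_i\rangle\in\mathcal W\cup\{\langle H,T\rangle\}$. $\langle\mathcal W',H',T'\rangle\preceq\langle\mathcal W,H,T\rangle$ iff $T'=T$, $H'\subseteq H$, every $\langle H_i,T_i\rangle\in\mathcal W$ has some $\langle H'_i,T_i\rangle\in\mathcal W'$ with $H'_i\subseteq H_i$, and every $\langle H'_i,T_i\rangle\in\mathcal W'$ has some $\langle H_i,T_i\rangle\in\mathcal W$ with $H'_i\subseteq H_i$. A total $\langle\mathcal W,T,T\rangle$ is an equilibrium belief model of $\Gamma$ if it is a belief model and no belief model is strictly $\prec$ below it; $\mathrm{EQB}[\Gamma]$ is their set. A (total) belief view $\mathcal W$ is an equilibrium world view of $\Gamma$ iff $\mathcal W=\{T:\langle\mathcal W,T,T\rangle\in\mathrm{EQB}[\Gamma]\}$. -}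

module Defs where

open import Data.Bool using (Bool; true; false)
open import Data.Nat using (ℕ; _<_; _+_)
open import Data.List using (List; []; _∷_; length)
open import Data.List.Membership.Propositional using (_∈_)
open import Data.Product using (Σ; ∃; _×_; _,_)
open import Data.Sum using (_⊎_)
open import Data.Empty using (⊥)
open import Data.Unit using (⊤)
open import Relation.Nullary using (¬_)
open import Relation.Binary.PropositionalEquality using (_≡_)

module _ {At : Set} where

  infixr 6 _∧′_
  infixr 5 _∨′_
  infixr 4 _⇒_
  data Formula : Set where
    ⊥′   : Formula
    atom : At → Formula
    _∧′_ : Formula → Formula → Formula
    _∨′_ : Formula → Formula → Formula
    _⇒_  : Formula → Formula → Formula
    𝐋    : Formula → Formula

  ¬′_ : Formula → Formula
  ¬′ φ = φ ⇒ ⊥′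

  ⊤′ : Formula
  ⊤′ = ¬′ ⊥′

  -- Sets of atoms (propositional interpretations) as decidable subsets
  Interp : Set
  Interp = At → Bool

  BeliefView : Set₁
  BeliefView = Interp → Set

  _⊆_ : Interp → Interp → Set
  A ⊆ B = ∀ a → A a ≡ true → B a ≡ true

  _≗_ : Interp → Interp → Set
  A ≗ B = ∀ a → A a ≡ B a

  _,_⊨_ : BeliefView → Interp → Formula → Set
  𝒲 , I ⊨ ⊥′ = ⊥
  𝒲 , I ⊨ atom a = I a ≡ true
  𝒲 , I ⊨ (φ ∧′ ψ) = (𝒲 , I ⊨ φ) × (𝒲 , I ⊨ ψ)
  𝒲 , I ⊨ (φ ∨′ ψ) = (𝒲 , I ⊨ φ) ⊎ (𝒲 , I ⊨ ψ)
  𝒲 , I ⊨ (φ ⇒ ψ) = (𝒲 , I ⊨ φ) → (𝒲 , I ⊨ ψ)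
  𝒲 , I ⊨ 𝐋 ψ = ∀ J → 𝒲 J → 𝒲 , J ⊨ ψ

  data ObjLit : Set where
    pos    : At → ObjLit
    neg    : At → ObjLit
    negneg : At → ObjLit

  data Literal : Set where
    obj    : ObjLit → Literal
    L      : ObjLit → Literal
    notL   : ObjLit → Literal
    notnotL : ObjLit → Literal

  objF : ObjLit → Formula
  objF (pos a) = atom a
  objF (neg a) = ¬′ atom a
  objF (negneg a) = ¬′ ¬′ atom a

  litF : Literal → Formula
  litF (obj l) = objF l
  litF (L l) = 𝐋 (objF l)
  litF (notL l) = ¬′ 𝐋 (objF l)
  litF (notnotL l) = ¬′ ¬′ 𝐋 (objF l)

  record Rule : Set where
    field
      head     : List At
      body     : List Literal
      nonempty : 0 < length head + length body
  open Rule public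

  disj : List At → Formula
  disj [] = ⊥′
  disj (a ∷ []) = atom a
  disj (a ∷ as@(_ ∷ _)) = atom a ∨′ disj as

  conj : List Literal → Formula
  conj [] = ⊤′
  conj (b ∷ []) = litF b
  conj (b ∷ bs@(_ ∷ _)) = litF b ∧′ conj bs

  Body : Rule → Formula
  Body r = conj (body r)

  ruleF : Rule → Formula
  ruleF r = Body r ⇒ disj (head r)

  _∈Body⁺ob_ : At → Rule → Set
  a ∈Body⁺ob r = obj (pos a) ∈ body r

  _∈Body⁺sub_ : At → Rule → Set
  a ∈Body⁺sub r = L (pos a) ∈ body r

  Program : Set₁
  Program = Rule → Set

  PairSet : Set₁
  PairSet = Interp → Interp → Set

  UnionY : PairSet → At → Set
  UnionY 𝒰 a = Σ Interp λ X' → Σ Interp λ I' → 𝒰 X' I' × X' a ≡ true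

  Supports : Program → BeliefView → PairSet → Interp → Interp → Rule → Set
  Supports Π 𝒲 𝒰 X I r =
      (𝒲 , I ⊨ Body r)
    × (∀ a → a ∈Body⁺ob r → X a ≡ false)
    × (∀ a → a ∈ head r → X a ≡ false → I a ≡ false)
    × (∀ a → a ∈Body⁺sub r → ¬ UnionY 𝒰 a)

  IsUnfoundedSet : Program → BeliefView → PairSet → Set
  IsUnfoundedSet Π 𝒲 𝒰 =
      (Σ Interp λ X → Σ Interp λ I → 𝒰 X I)
    × (∀ X I → 𝒰 X I → ∀ r → Π r →
         (Σ At λ a → a ∈ head r × X a ≡ true) →
         ¬ Supports Π 𝒲 𝒰 X I r)

  Unfounded : Program → BeliefView → Set₁
  Unfounded Π 𝒲 = Σ PairSet λ 𝒰 → IsUnfoundedSet Π 𝒲 𝒰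
    × (∀ X I → 𝒰 X I → 𝒲 I × (Σ At λ a → X a ≡ true × I a ≡ true))

  Founded : Program → BeliefView → Set₁
  Founded Π 𝒲 = ¬ Unfounded Π 𝒲

  HTView : Set₁
  HTView = Interp → Interp → Set

  IsHTView : HTView → Set
  IsHTView 𝒲 = (Σ Interp λ H → Σ Interp λ T → 𝒲 H T)
             × (∀ H T → 𝒲 H T → H ⊆ T)

  totalOf : HTView → HTView
  totalOf 𝒲 H T = (H ≗ T) × (Σ Interp λ H' → 𝒲 H' T)

  HTsat : HTView → Interp → Interp → Formula → Set
  HTsat 𝒲 H T ⊥′ = ⊥
  HTsat 𝒲 H T (atom a) = H a ≡ true
  HTsat 𝒲 H T (φ ∧′ ψ) = HTsat 𝒲 H T φ × HTsat 𝒲 H T ψ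
  HTsat 𝒲 H T (φ ∨′ ψ) = HTsat 𝒲 H T φ ⊎ HTsat 𝒲 H T ψ
  HTsat 𝒲 H T (φ ⇒ ψ) =
      (HTsat 𝒲 H T φ → HTsat 𝒲 H T ψ)
    × (HTsat (totalOf 𝒲) T T φ → HTsat (totalOf 𝒲) T T ψ)
  HTsat 𝒲 H T (𝐋 ψ) = ∀ Hᵢ Tᵢ → 𝒲 Hᵢ Tᵢ → HTsat 𝒲 Hᵢ Tᵢ ψ

  BeliefModel : Program → HTView → Interp → Interp → Set
  BeliefModel Π 𝒲 H T =
      IsHTView 𝒲 × H ⊆ T
    × (∀ r → Π r →
         (∀ Hᵢ Tᵢ → 𝒲 Hᵢ Tᵢ → HTsat 𝒲 Hᵢ Tᵢ (ruleF r))
       × HTsat 𝒲 H T (ruleF r))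

  _≼_ : (HTView × Interp × Interp) → (HTView × Interp × Interp) → Set
  (𝒲' , H' , T') ≼ (𝒲 , H , T) =
      T' ≗ T × H' ⊆ H
    × (∀ Hᵢ Tᵢ → 𝒲 Hᵢ Tᵢ → Σ Interp λ H'ᵢ → 𝒲' H'ᵢ Tᵢ × H'ᵢ ⊆ Hᵢ)
    × (∀ H'ᵢ Tᵢ → 𝒲' H'ᵢ Tᵢ → Σ Interp λ Hᵢ → 𝒲 Hᵢ Tᵢ × H'ᵢ ⊆ Hᵢ)

  _≐_ : HTView → HTView → Set
  𝒲 ≐ 𝒱 = (∀ H T → 𝒲 H T → Σ Interp λ H' → Σ Interp λ T' → 𝒱 H' T' × H ≗ H' × T ≗ T')
        × (∀ H T → 𝒱 H T → Σ Interp λ H' → Σ Interp λ T' → 𝒲 H' T' × H ≗ H' × T ≗ T')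

  _≈ᵢ_ : (HTView × Interp × Interp) → (HTView × Interp × Interp) → Set
  (𝒲' , H' , T') ≈ᵢ (𝒲 , H , T) = 𝒲' ≐ 𝒲 × H' ≗ H × T' ≗ T

  _≺_ : (HTView × Interp × Interp) → (HTView × Interp × Interp) → Set
  x ≺ y = x ≼ y × ¬ (x ≈ᵢ y)

  Total : HTView → Set
  Total 𝒲 = ∀ H T → 𝒲 H T → H ≗ T

  EquilibriumBeliefModel : Program → HTView → Interp → Set₁
  EquilibriumBeliefModel Π 𝒲 T =
      Total 𝒲 × BeliefModel Π 𝒲 T T
    × (∀ 𝒲' H' T' → BeliefModel Π 𝒲' H' T' → ¬ ((𝒲' , H' , T') ≺ (𝒲 , T , T)))

  toHT : BeliefView → HTView
  toHT 𝒲 H T = 𝒲 T × H ≗ T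

  EquilibriumWorldView : Program → BeliefView → Set₁
  EquilibriumWorldView Π 𝒲 =
    ∀ T → (𝒲 T → EquilibriumBeliefModel Π (toHT 𝒲) T)
        × (EquilibriumBeliefModel Π (toHT 𝒲) T → 𝒲 T)

-- If ⟨X₀ , I₀⟩ belongs to an unfounded set 𝒰 covering 𝒲, then adding to the total
-- view of 𝒲 the pairs ⟨T ∖ X , T⟩ for ⟨X , T⟩ ∈ 𝒰 gives an HT view over 𝒲 in which
-- every rule of Π holds at every point, in particular at ⟨I₀ ∖ X₀ , I₀⟩: a rule that
-- failed at ⟨T ∖ X , T⟩ would satisfy conditions (1)–(4) for ⟨X , T⟩, because an
-- atom a with 𝐋 a in its body is true at every ⟨T′ ∖ X′ , T′⟩ and so lies outside Y.
-- Since X₀ meets I₀, this belief model lies strictly below ⟨𝒲 , I₀ , I₀⟩,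
-- contradicting that ⟨𝒲 , I₀ , I₀⟩ is an equilibrium belief model.
module Submission where

open import Level using (0ℓ)
open import Axiom.ExcludedMiddle using (ExcludedMiddle)
open import Defs
open import Data.Bool using (true; false; _∧_; not; _≟_)
open import Data.List using (List; []; _∷_)
open import Data.List.Membership.Propositional using (_∈_; lose; find)
open import Data.List.Relation.Unary.Any as Any using (Any; here; there; any?)
open import Data.List.Relation.Unary.All using (All; []; _∷_; lookup)
open import Data.Product using (Σ; _×_; _,_; proj₁)
import Data.Product as Product
open import Data.Sum using (_⊎_; inj₁; inj₂)
import Data.Sum as Sum
open import Data.Empty using (⊥-elim)
open import Function using (_⇔_; mk⇔; Equivalence)
open import Relation.Nullary using (¬_; yes; no)
open import Relation.Binary.PropositionalEquality using (_≡_; refl; sym; trans)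

open Equivalence using (to; from)

module _ {At : Set} where

  _∖_ : Interp {At} → Interp {At} → Interp {At}
  (T ∖ X) a = T a ∧ not (X a)

  module _ (T X : Interp {At}) where

    ∖-⊆ : (T ∖ X) ⊆ T
    ∖-⊆ a p with T a
    ... | true = refl

    ∈∖⇒∉ : ∀ {a} → (T ∖ X) a ≡ true → X a ≡ false
    ∈∖⇒∉ {a} p with T a | X a
    ∈∖⇒∉ refl | true | false = refl

    ∈⇒∉∖ : ∀ {a} → X a ≡ true → (T ∖ X) a ≡ false
    ∈⇒∉∖ {a} x with T a | X a
    ∈⇒∉∖ refl | true | true = refl
    ∈⇒∉∖ refl | false | true = refl

    ∉∖⇒∈ : ∀ {a} → ¬ (T ∖ X) a ≡ true → T a ≡ true → X a ≡ true
    ∉∖⇒∈ {a} n t with T a | X a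
    ... | true | true = refl
    ... | true | false = ⊥-elim (n refl)
    ∉∖⇒∈ n () | false | _

    ∉∖⇒∉ : ∀ {a} → ¬ (T ∖ X) a ≡ true → X a ≡ false → T a ≡ false
    ∉∖⇒∉ {a} n x with T a | X a
    ... | false | _ = refl
    ... | true | false = ⊥-elim (n refl)
    ∉∖⇒∉ n () | true | true

    ∖-≉ : ∀ {a} → X a ≡ true → T a ≡ true → ¬ (T ∖ X) ≗ T
    ∖-≉ {a} x t e with trans (sym (∈⇒∉∖ x)) (trans (e a) t)
    ... | ()

  HTsat-disj-intro : ∀ 𝒱 H T (hs : List At) → Any (λ a → H a ≡ true) hs → HTsat 𝒱 H T (disj hs)
  HTsat-disj-intro 𝒱 H T (_ ∷ []) (here p) = p
  HTsat-disj-intro 𝒱 H T (_ ∷ _ ∷ _) (here p) = inj₁ p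
  HTsat-disj-intro 𝒱 H T (_ ∷ hs@(_ ∷ _)) (there p) = inj₂ (HTsat-disj-intro 𝒱 H T hs p)

  ⊨-disj-elim : ∀ 𝒲 T (hs : List At) → 𝒲 , T ⊨ disj hs → Any (λ a → T a ≡ true) hs
  ⊨-disj-elim 𝒲 T (_ ∷ []) p = here p
  ⊨-disj-elim 𝒲 T (_ ∷ _ ∷ _) (inj₁ p) = here p
  ⊨-disj-elim 𝒲 T (_ ∷ hs@(_ ∷ _)) (inj₂ p) = there (⊨-disj-elim 𝒲 T hs p)

  HTsat-conj-elim : ∀ 𝒱 H T (bs : List (Literal {At})) →
    HTsat 𝒱 H T (conj bs) → All (λ b → HTsat 𝒱 H T (litF b)) bs
  HTsat-conj-elim 𝒱 H T [] _ = []
  HTsat-conj-elim 𝒱 H T (_ ∷ []) p = p ∷ []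
  HTsat-conj-elim 𝒱 H T (_ ∷ bs@(_ ∷ _)) (p , q) = p ∷ HTsat-conj-elim 𝒱 H T bs q

  record HTViewOver (𝒲 : BeliefView {At}) (𝒱 : HTView {At}) : Set where
    field
      pair-⊆     : ∀ {H T} → 𝒱 H T → H ⊆ T
      pair-world : ∀ {H T} → 𝒱 H T → 𝒲 T
      world-pair : ∀ {T} → 𝒲 T → 𝒱 T T
  open HTViewOver public

  totalOf-total : ∀ (𝒱 : HTView {At}) → Total (totalOf 𝒱)
  totalOf-total 𝒱 H T (e , _) = e

  module _ {𝒲 : BeliefView {At}} where

    totalOf-over : ∀ {𝒱} → HTViewOver 𝒲 𝒱 → HTViewOver 𝒲 (totalOf 𝒱)
    totalOf-over o = record
      { pair-⊆     = λ (e , _) a p → trans (sym (e a)) p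
      ; pair-world = λ (_ , _ , v) → pair-world o v
      ; world-pair = λ {T} w → (λ _ → refl) , T , world-pair o w
      }

    toHT-over : HTViewOver 𝒲 (toHT 𝒲)
    toHT-over = record
      { pair-⊆     = λ (_ , e) a p → trans (sym (e a)) p
      ; pair-world = proj₁
      ; world-pair = λ w → w , λ _ → refl
      }

    toHT-total : Total (toHT 𝒲)
    toHT-total H T (_ , e) = e

    HTsat-total⇔⊨ : ∀ {𝒱} → HTViewOver 𝒲 𝒱 → Total 𝒱 →
      ∀ {H T} → H ≗ T → ∀ φ → HTsat 𝒱 H T φ ⇔ (𝒲 , T ⊨ φ)
    HTsat-total⇔⊨ o t e ⊥′ = mk⇔ (λ ()) (λ ())
    HTsat-total⇔⊨ o t e (atom a) = mk⇔ (trans (sym (e a))) (trans (e a))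
    HTsat-total⇔⊨ o t e (φ ∧′ ψ) =
      mk⇔ (Product.map (to (HTsat-total⇔⊨ o t e φ)) (to (HTsat-total⇔⊨ o t e ψ)))
          (Product.map (from (HTsat-total⇔⊨ o t e φ)) (from (HTsat-total⇔⊨ o t e ψ)))
    HTsat-total⇔⊨ o t e (φ ∨′ ψ) =
      mk⇔ (Sum.map (to (HTsat-total⇔⊨ o t e φ)) (to (HTsat-total⇔⊨ o t e ψ)))
          (Sum.map (from (HTsat-total⇔⊨ o t e φ)) (from (HTsat-total⇔⊨ o t e ψ)))
    HTsat-total⇔⊨ {𝒱} o t {H} {T} e (φ ⇒ ψ) =
      mk⇔ (λ (f , _) p → to (at-H ψ) (f (from (at-H φ) p)))
          (λ f → (λ p → from (at-H ψ) (f (to (at-H φ) p)))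
               , (λ p → from (at-T ψ) (f (to (at-T φ) p))))
      where
      at-H : ∀ χ → HTsat 𝒱 H T χ ⇔ (𝒲 , T ⊨ χ)
      at-T : ∀ χ → HTsat (totalOf 𝒱) T T χ ⇔ (𝒲 , T ⊨ χ)
      at-H = HTsat-total⇔⊨ o t e
      at-T = HTsat-total⇔⊨ (totalOf-over o) (totalOf-total 𝒱) (λ _ → refl)
    HTsat-total⇔⊨ o t e (𝐋 φ) =
      mk⇔ (λ f J w → to (HTsat-total⇔⊨ o t (λ _ → refl) φ) (f J J (world-pair o w)))
          (λ f Hᵢ Tᵢ v → from (HTsat-total⇔⊨ o t (t Hᵢ Tᵢ v) φ) (f Tᵢ (pair-world o v)))

    HTsat-totalOf⇔⊨ : ∀ {𝒱} → HTViewOver 𝒲 𝒱 → ∀ {T} φ → HTsat (totalOf 𝒱) T T φ ⇔ (𝒲 , T ⊨ φ)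
    HTsat-totalOf⇔⊨ {𝒱} o = HTsat-total⇔⊨ (totalOf-over o) (totalOf-total 𝒱) (λ _ → refl)

    HTsat⇒⊨ : ∀ {𝒱} → HTViewOver 𝒲 𝒱 → ∀ {H T} → H ⊆ T → ∀ φ → HTsat 𝒱 H T φ → 𝒲 , T ⊨ φ
    HTsat⇒⊨ o s (atom a) p = s a p
    HTsat⇒⊨ o s (φ ∧′ ψ) (p , q) = HTsat⇒⊨ o s φ p , HTsat⇒⊨ o s ψ q
    HTsat⇒⊨ o s (φ ∨′ ψ) (inj₁ p) = inj₁ (HTsat⇒⊨ o s φ p)
    HTsat⇒⊨ o s (φ ∨′ ψ) (inj₂ q) = inj₂ (HTsat⇒⊨ o s ψ q)
    HTsat⇒⊨ o s (φ ⇒ ψ) (_ , f) p =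
      to (HTsat-totalOf⇔⊨ o ψ) (f (from (HTsat-totalOf⇔⊨ o φ) p))
    HTsat⇒⊨ o s (𝐋 φ) p J w = HTsat⇒⊨ o (λ _ q → q) φ (p J J (world-pair o w))

    HTsat-⇒-intro : ∀ {𝒱} → HTViewOver 𝒲 𝒱 → ∀ {H T} φ ψ → 𝒲 , T ⊨ (φ ⇒ ψ) →
      (HTsat 𝒱 H T φ → HTsat 𝒱 H T ψ) → HTsat 𝒱 H T (φ ⇒ ψ)
    HTsat-⇒-intro o φ ψ c f =
      f , λ p → from (HTsat-totalOf⇔⊨ o ψ) (c (to (HTsat-totalOf⇔⊨ o φ) p))

    beliefModel⇒⊨ : ∀ {Π T} → BeliefModel Π (toHT 𝒲) T T →
      ∀ {r} → Π r → ∀ {S} → 𝒲 S → 𝒲 , S ⊨ ruleF r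
    beliefModel⇒⊨ (_ , _ , rules) {r} pr w =
      to (HTsat-total⇔⊨ toHT-over toHT-total (λ _ → refl) (ruleF r))
         (proj₁ (rules r pr) _ _ (world-pair toHT-over w))

    over⇒≺toHT : ∀ {𝒱} → HTViewOver 𝒲 𝒱 → ∀ {H T} → H ⊆ T → ¬ H ≗ T →
      (𝒱 , H , T) ≺ (toHT 𝒲 , T , T)
    over⇒≺toHT o s n =
        ( (λ _ → refl) , s
        , (λ Hᵢ Tᵢ (w , e) → Tᵢ , world-pair o w , λ a p → trans (e a) p)
        , (λ H′ᵢ Tᵢ v → Tᵢ , world-pair toHT-over (pair-world o v) , pair-⊆ o v) )
      , λ (_ , e , _) → n e

module Countermodel {At : Set} (Π : Program {At}) (𝒲 : BeliefView {At}) (𝒰 : PairSet {At})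
  (unfounded : ∀ X I → 𝒰 X I → ∀ r → Π r →
     (Σ At λ a → a ∈ head r × X a ≡ true) → ¬ Supports Π 𝒲 𝒰 X I r)
  (covered : ∀ {X I} → 𝒰 X I → 𝒲 I)
  (classical : ∀ {r} → Π r → ∀ {T} → 𝒲 T → 𝒲 , T ⊨ ruleF r) where

  𝒲ᵁ : HTView {At}
  𝒲ᵁ H T = 𝒲 T × (H ≗ T ⊎ Σ Interp λ X → 𝒰 X T × H ≗ (T ∖ X))

  𝒲ᵁ-over : HTViewOver 𝒲 𝒲ᵁ
  𝒲ᵁ-over = record
    { pair-⊆     = λ where
        (_ , inj₁ e) a p → trans (sym (e a)) p
        {T = T} (_ , inj₂ (X , _ , e)) a p → ∖-⊆ T X a (trans (sym (e a)) p)
    ; pair-world = proj₁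
    ; world-pair = λ w → w , inj₁ λ _ → refl
    }

  unfounded-point : ∀ {X T} → 𝒰 X T → 𝒲ᵁ (T ∖ X) T
  unfounded-point u = covered u , inj₂ (_ , u , λ _ → refl)

  supports : ∀ {r X T H} → 𝒰 X T → H ≗ (T ∖ X) → HTsat 𝒲ᵁ H T (Body r) →
    ¬ Any (λ a → (T ∖ X) a ≡ true) (head r) → Supports Π 𝒲 𝒰 X T r
  supports {r} {X} {T} {H} u e hb n =
      HTsat⇒⊨ 𝒲ᵁ-over (pair-⊆ 𝒲ᵁ-over (covered u , inj₂ (_ , u , e))) (Body r) hb
    , (λ a m → ∈∖⇒∉ T X (trans (sym (e a)) (literal m)))
    , (λ a m → ∉∖⇒∉ T X λ d → n (lose m d))
    , (λ a m (X′ , T′ , u′ , x′) →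
         case-false (trans (sym (∈⇒∉∖ T′ X′ x′)) (literal m _ _ (unfounded-point u′))))
    where
    literal : ∀ {b} → b ∈ body r → HTsat 𝒲ᵁ H T (litF b)
    literal = lookup (HTsat-conj-elim 𝒲ᵁ H T (body r) hb)
    case-false : ∀ {A : Set} → false ≡ true → A
    case-false ()

  rule-holds : ∀ {r} → Π r → ∀ H T → 𝒲ᵁ H T → HTsat 𝒲ᵁ H T (ruleF r)
  rule-holds {r} pr H T v@(w , c) =
    HTsat-⇒-intro 𝒲ᵁ-over (Body r) (disj (head r)) (classical pr w) (head-holds c)
    where
    head-holds : H ≗ T ⊎ Σ Interp (λ X → 𝒰 X T × H ≗ (T ∖ X)) →
      HTsat 𝒲ᵁ H T (Body r) → HTsat 𝒲ᵁ H T (disj (head r))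
    head-holds (inj₁ e) hb =
      HTsat-disj-intro 𝒲ᵁ H T (head r)
        (Any.map (trans (e _))
          (⊨-disj-elim 𝒲 T (head r)
            (classical pr w (HTsat⇒⊨ 𝒲ᵁ-over (pair-⊆ 𝒲ᵁ-over v) (Body r) hb))))
    head-holds (inj₂ (X , u , e)) hb with any? (λ a → (T ∖ X) a ≟ true) (head r)
    ... | yes d = HTsat-disj-intro 𝒲ᵁ H T (head r) (Any.map (trans (e _)) d)
    ... | no n = ⊥-elim (unfounded X T u r pr head-in-X s)
      where
      s : Supports Π 𝒲 𝒰 X T r
      s = supports {r} u e hb n
      head-in-X : Σ At λ a → a ∈ head r × X a ≡ true
      head-in-X with find (⊨-disj-elim 𝒲 T (head r) (classical pr w (proj₁ s)))
      ... | a , m , t = a , m , ∉∖⇒∈ T X (λ d → n (lose m d)) t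

  𝒲ᵁ-beliefModel : ∀ {X T} → 𝒰 X T → BeliefModel Π 𝒲ᵁ (T ∖ X) T
  𝒲ᵁ-beliefModel {X} {T} u =
      ((T , T , world-pair 𝒲ᵁ-over (covered u)) , λ _ _ → pair-⊆ 𝒲ᵁ-over)
    , ∖-⊆ T X
    , λ r pr → rule-holds pr , rule-holds pr _ _ (unfounded-point u)

theorem2 : (At : Set) → ExcludedMiddle 0ℓ →
    (Π : Program {At}) (𝒲 : BeliefView {At}) →
    EquilibriumWorldView Π 𝒲 → Founded Π 𝒲
theorem2 At _ Π 𝒲 ewv (𝒰 , ((X₀ , I₀ , u₀) , unfounded) , covers)
  with covers X₀ I₀ u₀
... | w₀ , a , X₀a , I₀a with proj₁ (ewv I₀) w₀
...   | _ , model , minimal =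
  minimal 𝒲ᵁ (I₀ ∖ X₀) I₀ (𝒲ᵁ-beliefModel u₀)
    (over⇒≺toHT 𝒲ᵁ-over (∖-⊆ I₀ X₀) (∖-≉ I₀ X₀ X₀a I₀a))
  where
  open Countermodel Π 𝒲 𝒰 unfounded (λ u → proj₁ (covers _ _ u)) (beliefModel⇒⊨ model)
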